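{- Let $G$ be a graph and $S_{vc}$ a minimum vertex cover of $G$. For any mixed dominating set $D$ of $G$, $2|D|\geq |V_D|+2|E_D|\geq |S_{vc}|$, where $V_D=D\cap V$ and $E_D=D\cap E$.
   Context: In a graph $G=(V,E)$, a vertex dominates itself, all its neighbours and all edges incident to it; an edge dominates itself, its two endpoints and all edges sharing an endpoint with it. A mixed dominating set is a set $D\subseteq V\cup E$ such that every vertex and every edge is dominated by at least one element of $D$. A vertex cover is a set of vertices containing at least one endpoint of every edge. -}

module Defs where

open import Data.Nat using (ℕ; _≤_)
open import Data.Fin using (Fin)
open import Data.Fin.Subset using (Subset; _∈_; ∣_∣)
open import Data.Product using (_×_; _,_; proj₁; proj₂; ∃-syntax)
open import Data.Sum using (_⊎_)
open import Relation.Binary.PropositionalEquality using (_≡_; _≢_)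
open import Relation.Nullary using (¬_)

record Graph : Set where
  field
    n : ℕ
    m : ℕ
    ends : Fin m → Fin n × Fin n
    loopless : ∀ e → proj₁ (ends e) ≢ proj₂ (ends e)
    simple : ∀ e f → (proj₁ (ends e) ≡ proj₁ (ends f) × proj₂ (ends e) ≡ proj₂ (ends f))
                   ⊎ (proj₁ (ends e) ≡ proj₂ (ends f) × proj₂ (ends e) ≡ proj₁ (ends f))
                   → e ≡ f

module _ (G : Graph) where
  open Graph G

  V = Fin n
  E = Fin m

  Inc : V → E → Set
  Inc v e = v ≡ proj₁ (ends e) ⊎ v ≡ proj₂ (ends e)

  Adj : V → V → Set
  Adj u v = ∃[ e ] ((u ≡ proj₁ (ends e) × v ≡ proj₂ (ends e))
                   ⊎ (u ≡ proj₂ (ends e) × v ≡ proj₁ (ends e)))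

  ShareEnd : E → E → Set
  ShareEnd e f = ∃[ v ] (Inc v e × Inc v f)

  VdomV : V → V → Set
  VdomV u v = u ≡ v ⊎ Adj u v
  VdomE : V → E → Set
  VdomE u e = Inc u e
  EdomV : E → V → Set
  EdomV f v = Inc v f
  EdomE : E → E → Set
  EdomE f e = f ≡ e ⊎ ShareEnd f e

  -- A mixed dominating set D ⊆ V ∪ E, given as (V_D , E_D) = (D ∩ V , D ∩ E).
  IsMixedDominatingSet : Subset n → Subset m → Set
  IsMixedDominatingSet VD ED =
    (∀ (v : V) → (∃[ u ] (u ∈ VD × VdomV u v)) ⊎ (∃[ f ] (f ∈ ED × EdomV f v)))
    × (∀ (e : E) → (∃[ u ] (u ∈ VD × VdomE u e)) ⊎ (∃[ f ] (f ∈ ED × EdomE f e)))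

  IsVertexCover : Subset n → Set
  IsVertexCover S = ∀ (e : E) → proj₁ (ends e) ∈ S ⊎ proj₂ (ends e) ∈ S

  IsMinimumVertexCover : Subset n → Set
  IsMinimumVertexCover S = IsVertexCover S × (∀ T → IsVertexCover T → ∣ S ∣ ≤ ∣ T ∣)

-- Every edge is dominated either by a vertex of V_D, which then covers it, or by
-- an edge of E_D sharing an endpoint with it (possibly itself). Hence V_D together
-- with the endpoints of the edges of E_D is a vertex cover, of size at most
-- |V_D| + 2|E_D|, and minimality of S_vc gives the first inequality.
module Submission where

open import Defs
open import Data.Nat using (ℕ; _≤_; _+_; _*_; s≤s; z≤n)
open import Data.Nat.Properties
  using (≤-trans; ≤-reflexive; n≤1+n; +-suc; +-mono-≤; +-monoʳ-≤; +-monoˡ-≤; m≤m+n; *-distribˡ-+; module ≤-Reasoning)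
open import Data.Product using (_×_; _,_; proj₁; proj₂)
open import Data.Sum as Sum using (_⊎_; inj₁; inj₂)
open import Data.Bool using (true; false)
open import Data.Vec using ([]; _∷_)
open import Data.Fin using (Fin; zero; suc)
open import Data.Fin.Subset using (Subset; ∣_∣; _∪_; ⊥; ⁅_⁆; _∈_)
open import Data.Fin.Subset.Properties using (x∈⁅x⁆; ∣⁅x⁆∣≡1; ∣⊥∣≡0; x∈p∪q⁺)
open import Data.Vec.Base using (here; there)
open import Function using (_∘_)
open import Relation.Binary.PropositionalEquality using (refl; sym; cong₂)

private
  variable
    k n : ℕ

∣p∪q∣≤∣p∣+∣q∣ : (p q : Subset n) → ∣ p ∪ q ∣ ≤ ∣ p ∣ + ∣ q ∣
∣p∪q∣≤∣p∣+∣q∣ []          []          = z≤n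
∣p∪q∣≤∣p∣+∣q∣ (true ∷ p)  (true ∷ q)  = s≤s (≤-trans (∣p∪q∣≤∣p∣+∣q∣ p q) (+-monoʳ-≤ ∣ p ∣ (n≤1+n ∣ q ∣)))
∣p∪q∣≤∣p∣+∣q∣ (true ∷ p)  (false ∷ q) = s≤s (∣p∪q∣≤∣p∣+∣q∣ p q)
∣p∪q∣≤∣p∣+∣q∣ (false ∷ p) (true ∷ q)  = ≤-trans (s≤s (∣p∪q∣≤∣p∣+∣q∣ p q)) (≤-reflexive (sym (+-suc ∣ p ∣ ∣ q ∣)))
∣p∪q∣≤∣p∣+∣q∣ (false ∷ p) (false ∷ q) = ∣p∪q∣≤∣p∣+∣q∣ p q

pairSet : Fin n × Fin n → Subset n
pairSet (u , v) = ⁅ u ⁆ ∪ ⁅ v ⁆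

∣pairSet∣≤2 : (uv : Fin n × Fin n) → ∣ pairSet uv ∣ ≤ 2
∣pairSet∣≤2 (u , v) = ≤-trans (∣p∪q∣≤∣p∣+∣q∣ ⁅ u ⁆ ⁅ v ⁆) (≤-reflexive (cong₂ _+_ (∣⁅x⁆∣≡1 u) (∣⁅x⁆∣≡1 v)))

endpoints : (Fin k → Fin n × Fin n) → Subset k → Subset n
endpoints ends []          = ⊥
endpoints ends (true ∷ s)  = pairSet (ends zero) ∪ endpoints (ends ∘ suc) s
endpoints ends (false ∷ s) = endpoints (ends ∘ suc) s

∣endpoints∣≤2*∣s∣ : (ends : Fin k → Fin n × Fin n) (s : Subset k) → ∣ endpoints ends s ∣ ≤ 2 * ∣ s ∣
∣endpoints∣≤2*∣s∣ {n = n} ends [] = ≤-reflexive (∣⊥∣≡0 n)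
∣endpoints∣≤2*∣s∣ ends (false ∷ s) = ∣endpoints∣≤2*∣s∣ (ends ∘ suc) s
∣endpoints∣≤2*∣s∣ ends (true ∷ s) = begin
  ∣ pairSet (ends zero) ∪ endpoints (ends ∘ suc) s ∣   ≤⟨ ∣p∪q∣≤∣p∣+∣q∣ (pairSet (ends zero)) _ ⟩
  ∣ pairSet (ends zero) ∣ + ∣ endpoints (ends ∘ suc) s ∣ ≤⟨ +-mono-≤ (∣pairSet∣≤2 (ends zero)) (∣endpoints∣≤2*∣s∣ (ends ∘ suc) s) ⟩
  2 + 2 * ∣ s ∣                                         ≡⟨ sym (*-distribˡ-+ 2 1 ∣ s ∣) ⟩
  2 * (1 + ∣ s ∣)                                       ∎
  where open ≤-Reasoning

proj₁∈pairSet : (uv : Fin n × Fin n) → proj₁ uv ∈ pairSet uv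
proj₁∈pairSet (u , v) = x∈p∪q⁺ (inj₁ (x∈⁅x⁆ u))

proj₂∈pairSet : (uv : Fin n × Fin n) → proj₂ uv ∈ pairSet uv
proj₂∈pairSet (u , v) = x∈p∪q⁺ (inj₂ (x∈⁅x⁆ v))

∈pairSet⇒∈endpoints : (ends : Fin k → Fin n × Fin n) {s : Subset k} {f : Fin k} {v : Fin n} →
                      f ∈ s → v ∈ pairSet (ends f) → v ∈ endpoints ends s
∈pairSet⇒∈endpoints ends here         v∈ = x∈p∪q⁺ (inj₁ v∈)
∈pairSet⇒∈endpoints ends {true ∷ s}  (there f∈s) v∈ = x∈p∪q⁺ (inj₂ (∈pairSet⇒∈endpoints (ends ∘ suc) f∈s v∈))
∈pairSet⇒∈endpoints ends {false ∷ s} (there f∈s) v∈ = ∈pairSet⇒∈endpoints (ends ∘ suc) f∈s v∈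

m+2n≤2[m+n] : (a b : ℕ) → a + 2 * b ≤ 2 * (a + b)
m+2n≤2[m+n] a b = begin
  a + 2 * b         ≤⟨ +-monoˡ-≤ (2 * b) (m≤m+n a (a + 0)) ⟩
  2 * a + 2 * b     ≡⟨ sym (*-distribˡ-+ 2 a b) ⟩
  2 * (a + b)       ∎
  where open ≤-Reasoning

module _ (G : Graph) where
  open Graph G using (ends)

  Inc⇒∈pairSet : ∀ {v e} → Inc G v e → v ∈ pairSet (ends e)
  Inc⇒∈pairSet {e = e} (inj₁ refl) = proj₁∈pairSet (ends e)
  Inc⇒∈pairSet {e = e} (inj₂ refl) = proj₂∈pairSet (ends e)

  Covers : Subset (Graph.n G) → E G → Set
  Covers T e = proj₁ (ends e) ∈ T ⊎ proj₂ (ends e) ∈ T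

  Covers-∪ˡ : ∀ {S T e} → Covers S e → Covers (S ∪ T) e
  Covers-∪ˡ = Sum.map (x∈p∪q⁺ ∘ inj₁) (x∈p∪q⁺ ∘ inj₁)

  Covers-∪ʳ : ∀ {S T e} → Covers T e → Covers (S ∪ T) e
  Covers-∪ʳ = Sum.map (x∈p∪q⁺ ∘ inj₂) (x∈p∪q⁺ ∘ inj₂)

  Inc∈⇒Covers : ∀ {T v e} → Inc G v e → v ∈ T → Covers T e
  Inc∈⇒Covers (inj₁ refl) v∈T = inj₁ v∈T
  Inc∈⇒Covers (inj₂ refl) v∈T = inj₂ v∈T

  sharesEndpointWith∈⇒Covers : ∀ {ED f e v} → f ∈ ED → Inc G v f → Inc G v e → Covers (endpoints ends ED) e
  sharesEndpointWith∈⇒Covers f∈ED v~f v~e = Inc∈⇒Covers v~e (∈pairSet⇒∈endpoints ends f∈ED (Inc⇒∈pairSet v~f))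

  mixedDominating⇒vertexCover : ∀ {VD ED} → IsMixedDominatingSet G VD ED →
                                IsVertexCover G (VD ∪ endpoints ends ED)
  mixedDominating⇒vertexCover (_ , edgesDominated) e with edgesDominated e
  ... | inj₁ (u , u∈VD , u~e)                   = Covers-∪ˡ (Inc∈⇒Covers u~e u∈VD)
  ... | inj₂ (f , f∈ED , inj₁ refl)             = Covers-∪ʳ (sharesEndpointWith∈⇒Covers f∈ED (inj₁ refl) (inj₁ refl))
  ... | inj₂ (f , f∈ED , inj₂ (v , v~f , v~e)) = Covers-∪ʳ (sharesEndpointWith∈⇒Covers f∈ED v~f v~e)

corollary1 : (G : Graph) (Svc : Subset (Graph.n G)) → IsMinimumVertexCover G Svc →
    (VD : Subset (Graph.n G)) (ED : Subset (Graph.m G)) → IsMixedDominatingSet G VD ED →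
    (∣ Svc ∣ ≤ ∣ VD ∣ + 2 * ∣ ED ∣) × (∣ VD ∣ + 2 * ∣ ED ∣ ≤ 2 * (∣ VD ∣ + ∣ ED ∣))
corollary1 G Svc (_ , minimum) VD ED dominating = Svc≤ , m+2n≤2[m+n] ∣ VD ∣ ∣ ED ∣
  where
  open Graph G using (ends)
  open ≤-Reasoning
  Svc≤ : ∣ Svc ∣ ≤ ∣ VD ∣ + 2 * ∣ ED ∣
  Svc≤ = begin
    ∣ Svc ∣                             ≤⟨ minimum _ (mixedDominating⇒vertexCover G dominating) ⟩
    ∣ VD ∪ endpoints ends ED ∣          ≤⟨ ∣p∪q∣≤∣p∣+∣q∣ VD (endpoints ends ED) ⟩
    ∣ VD ∣ + ∣ endpoints ends ED ∣      ≤⟨ +-monoʳ-≤ ∣ VD ∣ (∣endpoints∣≤2*∣s∣ ends ED) ⟩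
    ∣ VD ∣ + 2 * ∣ ED ∣                 ∎
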